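{- Let $w \in \{1,2,3\}^{\mathbb{N}}$ be such that $\rho_w(n) \le 3$ for every positive integer $n$ and $w$ admits letter frequencies which are rationally independent. Let $\ell$ be a positive integer and $r,s,t\in\mathbb{N}$ such that $$\mathrm{ab}(\mathcal{L}_\ell(w)) = \left\{ {}^t(r,s,t),\ {}^t(r+1,s-1,t),\ {}^t(r+2,s-1,t-1) \right\}.$$ Let $w' = I_\ell(w)$, written over the three-letter alphabet $\{a,b,c\} = \mathcal{L}_\ell(w)/\sim_{ab}$, and for each $\alpha \in \{a,b,c\}$ let $u_\alpha \in \mathcal{L}_\ell(w)$ with $\overline{u_\alpha} = \alpha$. Then for every positive integer $n$, every $u', v' \in \mathcal{L}_n(w')$ and every $\alpha \in \{a,b,c\}$ such that $|u'|_\alpha - |v'|_\alpha = 2$, we have $\mathrm{ab}(u_\alpha) = {}^t(r+1, s-1, t)$.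
   Context: For an infinite word $w$, $\mathcal{L}_n(w)$ is the set of length-$n$ factors (contiguous subwords), $|u|_i$ counts occurrences of the letter $i$ in $u$, letter frequencies are $f_w(i) = \lim_n |\mathrm{pref}_n(w)|_i/n$ with $\mathrm{pref}_n(w)$ the length-$n$ prefix; rationally independent means linearly independent over $\mathbb{Q}$. The abelianized vector of a finite word $u$ over $\{1,2,3\}$ is $\mathrm{ab}(u) = {}^t(|u|_1,|u|_2,|u|_3)$, and $\mathrm{ab}(\mathcal{L}_\ell(w)) = \{\mathrm{ab}(u) : u \in \mathcal{L}_\ell(w)\}$. Two finite words are abelian equivalent ($\sim_{ab}$) if they have the same number of occurrences of each letter; $\bar u$ is the abelian class of $u$; $\rho_w(n) = \mathrm{card}(\mathcal{L}_n(w)/\sim_{ab})$. The abelian induced word $I_\ell(w)$ is the infinite word over $\mathcal{L}_\ell(w)/\sim_{ab}$ with $I_\ell(w)[n] = \overline{w[n\ell:(n+1)\ell-1]}$, where $w[p:q]$ is the factor from position $p$ to $q$ inclusive. -}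

module Defs where

open import Data.Nat as ℕ using (ℕ; zero; suc; _+_; _*_; _∸_; _≤_)
import Data.Nat.Properties as ℕP
open import Data.Fin using (Fin)
import Data.Fin.Properties as FinP
open import Data.List using (List; map; upTo; filter; length)
open import Data.Product using (_×_; _,_; ∃; Σ)
open import Data.Product.Properties using (≡-dec)
open import Data.Sum using (_⊎_)
open import Relation.Binary.PropositionalEquality using (_≡_)
open import Relation.Nullary using (¬_)
open import Data.Integer using (+_)
open import Data.Rational as ℚ using (ℚ; 0ℚ; ∣_∣; _/_; _<_)

-- infinite words over {1,2,3}, letters coded as Fin 3 (0 ↦ 1, 1 ↦ 2, 2 ↦ 3)
Word : Set
Word = ℕ → Fin 3

factor : Word → ℕ → ℕ → List (Fin 3)
factor w i n = map (λ k → w (i + k)) (upTo n)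

count : Fin 3 → List (Fin 3) → ℕ
count a u = length (filter (λ x → x FinP.≟ a) u)

AbVec : Set
AbVec = ℕ × ℕ × ℕ

_≟ab_ : (x y : AbVec) → _
_≟ab_ = ≡-dec ℕP._≟_ (≡-dec ℕP._≟_ ℕP._≟_)

ab : List (Fin 3) → AbVec
ab u = count Fin.zero u , count (Fin.suc Fin.zero) u , count (Fin.suc (Fin.suc Fin.zero)) u
  where import Data.Fin as Fin

InAbL : Word → ℕ → AbVec → Set
InAbL w n v = ∃ λ i → ab (factor w i n) ≡ v

ρ≤3 : Word → ℕ → Set
ρ≤3 w n = Σ AbVec λ v₁ → Σ AbVec λ v₂ → Σ AbVec λ v₃ →
  (i : ℕ) → let v = ab (factor w i n) in (v ≡ v₁) ⊎ (v ≡ v₂) ⊎ (v ≡ v₃)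

AbLEq : Word → ℕ → AbVec → AbVec → AbVec → Set
AbLEq w n x y z =
  ((v : AbVec) → InAbL w n v → (v ≡ x) ⊎ (v ≡ y) ⊎ (v ≡ z))
  × InAbL w n x × InAbL w n y × InAbL w n z

freqSeq : Word → Fin 3 → ℕ → ℚ
freqSeq w a n = (+ count a (factor w 0 (suc n))) / suc n

-- a rational sequence is Cauchy (i.e. converges to a real number)
Cauchy : (ℕ → ℚ) → Set
Cauchy x = (ε : ℚ) → 0ℚ < ε → ∃ λ N → (m n : ℕ) → N ≤ m → N ≤ n → ∣ x m ℚ.- x n ∣ < ε

TendsToZero : (ℕ → ℚ) → Set
TendsToZero x = (ε : ℚ) → 0ℚ < ε → ∃ λ N → (n : ℕ) → N ≤ n → ∣ x n ∣ < ε

HasFrequencies : Word → Set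
HasFrequencies w = (a : Fin 3) → Cauchy (freqSeq w a)

RatIndepFreq : Word → Set
RatIndepFreq w = (q₁ q₂ q₃ : ℚ) → ¬ (q₁ ≡ 0ℚ × q₂ ≡ 0ℚ × q₃ ≡ 0ℚ) →
  ¬ TendsToZero (λ n → q₁ ℚ.* freqSeq w Fin.zero n
                     ℚ.+ q₂ ℚ.* freqSeq w (Fin.suc Fin.zero) n
                     ℚ.+ q₃ ℚ.* freqSeq w (Fin.suc (Fin.suc Fin.zero)) n)
  where import Data.Fin as Fin

-- the abelian induced word I_ℓ(w); its letter at n (the class of
-- w[nℓ : (n+1)ℓ-1]) is represented by the abelianized vector of that block
induced : Word → ℕ → ℕ → AbVec
induced w ℓ n = ab (factor w (n * ℓ) ℓ)

indFactor : Word → ℕ → ℕ → ℕ → List AbVec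
indFactor w ℓ i n = map (λ k → induced w ℓ (i + k)) (upTo n)

countInd : AbVec → List AbVec → ℕ
countInd α u = length (filter (λ x → x ≟ab α) u)

-- Cut w into blocks of length ℓ + 1, of types A = (r,s,t), B = (r+1,s−1,t) and C = (r+2,s−1,t−1).
-- A window of m consecutive blocks, a, b, c of them of the respective types, contains
-- m r + b + 2c letters 1, m (s−1) + a letters 2 and m (t−1) + a + b letters 3.
-- Sliding a window of fixed length along w changes each letter count by at most one, and
-- with at most three abelian classes such a count takes at most three consecutive values;
-- the same holds for b, which the class determines. A surplus of two A blocks then forces
-- the number of 2s to rise by two while the number of 3s stays put (for C: the 1s rise, the
-- 2s stay put). The three classes are the windows at the three levels of the rising count,
-- and balancing the window length shows that the steady count is the same in every window.
-- Its letter then has a rational frequency, contradicting rational independence.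

module Submission where

open import Defs
open import Data.Bool using (true; false; if_then_else_)
open import Data.Empty using (⊥; ⊥-elim)
open import Data.Fin as Fin using (Fin; toℕ)
open import Data.Fin.Patterns using (0F; 1F; 2F)
open import Data.Fin.Properties as Finₚ using (pigeonhole; toℕ≤pred[n]; all?)
open import Data.Integer as ℤ using (ℤ; _⊖_)
import Data.Integer.Properties as ℤₚ
import Data.Integer.Tactic.RingSolver as ℤ-Solver
open import Data.Integer.GCD using (gcd)
open import Data.List using (_∷_; map; upTo; applyUpTo; filter; length)
open import Data.List.Properties using (map-upTo)
open import Data.Nat using (ℕ; zero; suc; _+_; _∸_; _*_; _≤_; _<_; _⊔_; _<?_; _≤?_; z≤n; z<s)
open import Data.Nat.DivMod using (_%_; m≡m%n+[m/n]*n; m%n<n) renaming (_/_ to _div_)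
open import Data.Nat.Properties
open import Data.Nat.Tactic.RingSolver using (solve-∀)
open import Data.Product using (_×_; _,_; ∃; proj₁; proj₂)
open import Data.Rational as ℚ using (ℚ; mkℚ; 0ℚ; _/_; toℚᵘ)
import Data.Rational.Properties as ℚₚ
open import Data.Rational.Unnormalised as ℚᵘ using (mkℚᵘ; *≡*; *<*; _≃_)
import Data.Rational.Unnormalised.Properties as ℚᵘₚ
open import Data.Sum using (_⊎_; inj₁; inj₂)
open import Data.Vec using (Vec; []; _∷_; lookup)
open import Function using (_∘_)
open import Relation.Binary.Definitions using (DecidableEquality)
open import Relation.Binary.PropositionalEquality
open import Relation.Nullary using (yes; no; does; ¬_; contradiction)
open import Relation.Nullary.Decidable using (toWitness; ¬?; _→-dec_; _⊎-dec_)

OneLipschitz : (ℕ → ℕ) → Set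
OneLipschitz f = ∀ k → f (suc k) ≤ suc (f k) × f k ≤ suc (f (suc k))

module _ {f : ℕ → ℕ} (lip : OneLipschitz f) where

  private
    rising : ∀ q d {c} → f q ≤ c → c ≤ f (d + q) → ∃ λ k → f k ≡ c
    rising q zero    fq≤c c≤fq = q , ≤-antisym fq≤c c≤fq
    rising q (suc d) {c} fq≤c c≤f with c ≤? f (d + q)
    ... | yes c≤f′ = rising q d fq≤c c≤f′
    ... | no  c≰f′ = suc d + q , ≤-antisym (≤-trans (proj₁ (lip (d + q))) (≰⇒> c≰f′)) c≤f

    falling : ∀ q d {c} → c ≤ f q → f (d + q) ≤ c → ∃ λ k → f k ≡ c
    falling q zero    c≤fq fq≤c = q , ≤-antisym fq≤c c≤fq
    falling q (suc d) {c} c≤fq f≤c with f (d + q) ≤? c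
    ... | yes f′≤c = falling q d c≤fq f′≤c
    ... | no  f′≰c = suc d + q , ≤-antisym f≤c (≤-pred (≤-trans (≰⇒> f′≰c) (proj₂ (lip (d + q)))))

  intermediate-value : ∀ p q {c} → f q ≤ c → c ≤ f p → ∃ λ k → f k ≡ c
  intermediate-value p q {c} fq≤c c≤fp with ≤-total q p
  ... | inj₁ q≤p = rising q (p ∸ q) fq≤c (subst (λ k → c ≤ f k) (sym (m∸n+n≡m q≤p)) c≤fp)
  ... | inj₂ p≤q = falling p (q ∸ p) c≤fp (subst (λ k → f k ≤ c) (sym (m∸n+n≡m p≤q)) fq≤c)

module WindowCount {X : Set} (_≟ₓ_ : DecidableEquality X) where

  δ : X → X → ℕ
  δ a x = if does (x ≟ₓ a) then 1 else 0

  δ≤1 : ∀ a x → δ a x ≤ 1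
  δ≤1 a x with does (x ≟ₓ a)
  ... | true  = ≤-refl
  ... | false = z≤n

  δ-refl : ∀ a → δ a a ≡ 1
  δ-refl a with a ≟ₓ a
  ... | yes _   = refl
  ... | no  a≢a = contradiction refl a≢a

  δ-≢ : ∀ {a x} → x ≢ a → δ a x ≡ 0
  δ-≢ {a} {x} x≢a with x ≟ₓ a
  ... | yes x≡a = contradiction x≡a x≢a
  ... | no  _   = refl

  occ : X → (ℕ → X) → ℕ → ℕ → ℕ
  occ a h zero    i = 0
  occ a h (suc n) i = δ a (h i) + occ a h n (suc i)

  occ≤ : ∀ a h n i → occ a h n i ≤ n
  occ≤ a h zero    i = z≤n
  occ≤ a h (suc n) i = +-mono-≤ (δ≤1 a (h i)) (occ≤ a h n (suc i))

  occ-+ : ∀ a h m n i → occ a h (m + n) i ≡ occ a h m i + occ a h n (m + i)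
  occ-+ a h zero    n i = refl
  occ-+ a h (suc m) n i = begin
    δ a (h i) + occ a h (m + n) (suc i)                         ≡⟨ cong (δ a (h i) +_) (occ-+ a h m n (suc i)) ⟩
    δ a (h i) + (occ a h m (suc i) + occ a h n (m + suc i))     ≡⟨ sym (+-assoc (δ a (h i)) _ _) ⟩
    occ a h (suc m) i + occ a h n (m + suc i)                   ≡⟨ cong (λ j → occ a h (suc m) i + occ a h n j) (+-suc m i) ⟩
    occ a h (suc m) i + occ a h n (suc m + i)                   ∎
    where open ≡-Reasoning

  occ-slide : ∀ a h n i → occ a h n (suc i) + δ a (h i) ≡ occ a h n i + δ a (h (n + i))
  occ-slide a h n i = begin
    occ a h n (suc i) + δ a (h i)   ≡⟨ +-comm (occ a h n (suc i)) _ ⟩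
    occ a h (suc n) i               ≡⟨ cong (λ m → occ a h m i) (+-comm 1 n) ⟩
    occ a h (n + 1) i               ≡⟨ occ-+ a h n 1 i ⟩
    occ a h n i + (δ a (h (n + i)) + 0) ≡⟨ cong (occ a h n i +_) (+-identityʳ _) ⟩
    occ a h n i + δ a (h (n + i))   ∎
    where open ≡-Reasoning

  occ-oneLipschitz : ∀ a h n → OneLipschitz (occ a h n)
  occ-oneLipschitz a h n i =
    step (occ-slide a h n i) (δ≤1 a (h (n + i))) , step (sym (occ-slide a h n i)) (δ≤1 a (h i))
    where
    step : ∀ {x y d e} → x + d ≡ y + e → e ≤ 1 → x ≤ suc y
    step {x} {y} {d} {e} x+d≡y+e e≤1 = begin
      x       ≤⟨ m≤m+n x d ⟩
      x + d   ≡⟨ x+d≡y+e ⟩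
      y + e   ≤⟨ +-monoʳ-≤ y e≤1 ⟩
      y + 1   ≡⟨ +-comm y 1 ⟩
      suc y   ∎
      where open ≤-Reasoning

  private
    count-∷ : ∀ a x xs → length (filter (_≟ₓ a) (x ∷ xs)) ≡ δ a x + length (filter (_≟ₓ a) xs)
    count-∷ a x xs with does (x ≟ₓ a)
    ... | true  = refl
    ... | false = refl

    count-applyUpTo : ∀ a h n i {g} → (∀ k → g k ≡ h (i + k)) →
                      length (filter (_≟ₓ a) (applyUpTo g n)) ≡ occ a h n i
    count-applyUpTo a h zero    i g≗ = refl
    count-applyUpTo a h (suc n) i {g} g≗ = trans (count-∷ a (g 0) _) (cong₂ _+_
      (cong (δ a) (trans (g≗ 0) (cong h (+-identityʳ i))))
      (count-applyUpTo a h n (suc i) (λ k → trans (g≗ (suc k)) (cong h (+-suc i k)))))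

  count-window : ∀ a h i n → length (filter (_≟ₓ a) (map (λ k → h (i + k)) (upTo n))) ≡ occ a h n i
  count-window a h i n = trans (cong (length ∘ filter (_≟ₓ a)) (map-upTo (λ k → h (i + k)) n))
                               (count-applyUpTo a h n i (λ _ → refl))

_FactorsThrough_ : ∀ {m} → (ℕ → ℕ) → (ℕ → Fin m) → Set
f FactorsThrough κ = ∀ {a b} → κ a ≡ κ b → f a ≡ f b

-- Otherwise f passes through the m + 1 values f q, …, m + f q, which lie in distinct classes.
spread< : ∀ {m} (κ : ℕ → Fin m) {f} → OneLipschitz f → f FactorsThrough κ → ∀ p q → f p < m + f q
spread< {m} κ {f} lip f∣κ p q with f p <? m + f q
... | yes fp<m+fq = fp<m+fq
... | no  fp≮m+fq = ⊥-elim (Fin-collision (pigeonhole (n<1+n m) (κ ∘ witness)))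
  where
  level : Fin (suc m) → ℕ
  level i = toℕ i + f q

  reaches : ∀ i → ∃ λ k → f k ≡ level i
  reaches i = intermediate-value lip p q (m≤n+m (f q) (toℕ i))
                (≤-trans (+-monoˡ-≤ (f q) (toℕ≤pred[n] i)) (≮⇒≥ fp≮m+fq))

  witness : Fin (suc m) → ℕ
  witness i = proj₁ (reaches i)

  Fin-collision : (∃ λ i → ∃ λ j → i Fin.< j × κ (witness i) ≡ κ (witness j)) → ⊥
  Fin-collision (i , j , i<j , same) = <-irrefl (+-cancelʳ-≡ (f q) _ _ level≡) i<j
    where
    level≡ : level i ≡ level j
    level≡ = trans (sym (proj₂ (reaches i))) (trans (f∣κ same) (proj₂ (reaches j)))

Fin3-exhausted : ∀ (x y z u : Fin 3) → x ≢ y → x ≢ z → y ≢ z → u ≡ x ⊎ u ≡ y ⊎ u ≡ z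
Fin3-exhausted = toWitness {a? = all? λ x → all? λ y → all? λ z → all? λ u →
  ¬? (x Finₚ.≟ y) →-dec ¬? (x Finₚ.≟ z) →-dec ¬? (y Finₚ.≟ z) →-dec
  (u Finₚ.≟ x ⊎-dec u Finₚ.≟ y ⊎-dec u Finₚ.≟ z)} _

module _ (κ : ℕ → Fin 3) {F G H : ℕ → ℕ} {N : ℕ}
         (F-lip : OneLipschitz F) (H-lip : OneLipschitz H)
         (F∣κ : F FactorsThrough κ) (G∣κ : G FactorsThrough κ) (H∣κ : H FactorsThrough κ)
         (total : ∀ k → F k + G k + H k ≡ N) where

  -- The values F q, 1 + F q, 2 + F q single out all three classes, and the middle
  -- class is forced to trade one F for one H, leaving G unchanged.
  steady-count-is-constant : ∀ {p q} → F p ≡ 2 + F q → G p ≡ G q → ∀ k → G k ≡ G q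
  steady-count-is-constant {p} {q} Fp≡2+Fq Gp≡Gq k = by-class (classes k)
    where
    Hq≡2+Hp : H q ≡ 2 + H p
    Hq≡2+Hp = +-cancelˡ-≡ (F q + G q) _ _ (begin
      F q + G q + H q         ≡⟨ trans (total q) (sym (total p)) ⟩
      F p + G p + H p         ≡⟨ cong₂ (λ x y → x + y + H p) Fp≡2+Fq Gp≡Gq ⟩
      2 + F q + G q + H p     ≡⟨ shift (F q) (G q) (H p) ⟩
      F q + G q + (2 + H p)   ∎)
      where
      open ≡-Reasoning
      shift : ∀ x y z → 2 + x + y + z ≡ x + y + (2 + z)
      shift = solve-∀

    middle : ∃ λ m → F m ≡ 1 + F q
    middle = intermediate-value F-lip p q (n≤1+n (F q)) (subst (1 + F q ≤_) (sym Fp≡2+Fq) (n≤1+n _))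
    m = proj₁ middle
    Fm≡1+Fq = proj₂ middle

    classes : ∀ k → κ k ≡ κ q ⊎ κ k ≡ κ m ⊎ κ k ≡ κ p
    classes k = Fin3-exhausted (κ q) (κ m) (κ p) (κ k)
      (λ q~m → m≢1+n+m (F q) {0} (trans (F∣κ q~m) Fm≡1+Fq))
      (λ q~p → m≢1+n+m (F q) {1} (trans (F∣κ q~p) Fp≡2+Fq))
      (λ m~p → m≢1+n+m (1 + F q) {0} (trans (sym Fm≡1+Fq) (trans (F∣κ m~p) Fp≡2+Fq)))

    Hm≡1+Hp : H m ≡ 1 + H p
    Hm≡1+Hp with k₀ , Hk₀≡1+Hp ← intermediate-value H-lip q p (n≤1+n (H p))
                                   (subst (1 + H p ≤_) (sym Hq≡2+Hp) (n≤1+n _))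
                | classes k₀
    ... | inj₁ k₀~q        = contradiction (trans (sym Hk₀≡1+Hp) (trans (H∣κ k₀~q) Hq≡2+Hp)) (m≢1+n+m (1 + H p) {0})
    ... | inj₂ (inj₁ k₀~m) = trans (sym (H∣κ k₀~m)) Hk₀≡1+Hp
    ... | inj₂ (inj₂ k₀~p) = contradiction (trans (sym (H∣κ k₀~p)) Hk₀≡1+Hp) (m≢1+n+m (H p) {0})

    Gm≡Gq : G m ≡ G q
    Gm≡Gq = +-cancelʳ-≡ (2 + H p) _ _ (+-cancelˡ-≡ (F q) _ _ (begin
      F q + (G m + (2 + H p))   ≡⟨ shift (F q) (G m) (H p) ⟩
      1 + F q + G m + (1 + H p) ≡⟨ cong₂ (λ x y → x + G m + y) (sym Fm≡1+Fq) (sym Hm≡1+Hp) ⟩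
      F m + G m + H m           ≡⟨ trans (total m) (sym (total q)) ⟩
      F q + G q + H q           ≡⟨ trans (+-assoc (F q) (G q) (H q)) (cong (λ z → F q + (G q + z)) Hq≡2+Hp) ⟩
      F q + (G q + (2 + H p))   ∎))
      where
      open ≡-Reasoning
      shift : ∀ x y z → x + (y + (2 + z)) ≡ 1 + x + y + (1 + z)
      shift = solve-∀

    by-class : κ k ≡ κ q ⊎ κ k ≡ κ m ⊎ κ k ≡ κ p → G k ≡ G q
    by-class (inj₁ k~q)        = G∣κ k~q
    by-class (inj₂ (inj₁ k~m)) = trans (G∣κ k~m) Gm≡Gq
    by-class (inj₂ (inj₂ k~p)) = trans (G∣κ k~p) Gp≡Gq

module Letter = WindowCount (Finₚ._≟_ {3})
open Letter using (occ; occ≤; occ-+)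

letter-total : ∀ h n i → occ 0F h n i + occ 1F h n i + occ 2F h n i ≡ n
letter-total h zero    i = refl
letter-total h (suc n) i = trans (regroup (Letter.δ 0F (h i)) (Letter.δ 1F (h i)) (Letter.δ 2F (h i)) _ _ _)
                                 (cong₂ _+_ (one-letter (h i)) (letter-total h n (suc i)))
  where
  regroup : ∀ a b c x y z → (a + x) + (b + y) + (c + z) ≡ (a + b + c) + (x + y + z)
  regroup = solve-∀
  one-letter : ∀ x → Letter.δ 0F x + Letter.δ 1F x + Letter.δ 2F x ≡ 1
  one-letter 0F = refl
  one-letter 1F = refl
  one-letter 2F = refl

count-factor : ∀ w a i n → count a (factor w i n) ≡ occ a w n i
count-factor w a i n = Letter.count-window a w i n

count-total : ∀ w i n → count 0F (factor w i n) + count 1F (factor w i n) + count 2F (factor w i n) ≡ n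
count-total w i n = trans
  (cong₂ _+_ (cong₂ _+_ (count-factor w 0F i n) (count-factor w 1F i n)) (count-factor w 2F i n))
  (letter-total w n i)

-- Scoped so that the integer constructor +_ does not capture sections (x +_) on ℕ.
module _ where

  open import Data.Integer using (+_; -[1+_]; +0)

  private
    ×-over : ∀ z c n → toℚᵘ ((z / 1) ℚ.* (+ c / suc n)) ≃ mkℚᵘ (z ℤ.* + c) n
    ×-over z c n = begin
      toℚᵘ ((z / 1) ℚ.* (+ c / suc n))
        ≈⟨ ℚₚ.toℚᵘ-homo-* (z / 1) (+ c / suc n) ⟩
      toℚᵘ (z / 1) ℚᵘ.* toℚᵘ (+ c / suc n)
        ≈⟨ ℚᵘₚ.*-cong (ℚₚ.toℚᵘ-fromℚᵘ (mkℚᵘ z 0)) (ℚₚ.toℚᵘ-fromℚᵘ (mkℚᵘ (+ c) n)) ⟩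
      mkℚᵘ z 0 ℚᵘ.* mkℚᵘ (+ c) n
        ≈⟨ *≡* (cong (λ d → z ℤ.* + c ℤ.* + suc d) (sym (+-identityʳ n))) ⟩
      mkℚᵘ (z ℤ.* + c) n
        ∎
      where open ℚᵘₚ.≃-Reasoning

    +-over : ∀ a b n → mkℚᵘ a n ℚᵘ.+ mkℚᵘ b n ≃ mkℚᵘ (a ℤ.+ b) n
    +-over a b n = *≡* (trans (distrib a b (+ suc n))
                              (cong ((a ℤ.+ b) ℤ.*_) (sym (ℤₚ.pos-* (suc n) (suc n)))))
      where
      distrib : ∀ a b d → (a ℤ.* d ℤ.+ b ℤ.* d) ℤ.* d ≡ (a ℤ.+ b) ℤ.* (d ℤ.* d)
      distrib = ℤ-Solver.solve-∀

  -- mkℚᵘ d n stands for d / (n + 1).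
  combination-over : ∀ z₁ z₂ z₃ c₁ c₂ c₃ n →
    toℚᵘ ((z₁ / 1) ℚ.* (+ c₁ / suc n) ℚ.+ (z₂ / 1) ℚ.* (+ c₂ / suc n) ℚ.+ (z₃ / 1) ℚ.* (+ c₃ / suc n))
      ≃ mkℚᵘ (z₁ ℤ.* + c₁ ℤ.+ z₂ ℤ.* + c₂ ℤ.+ z₃ ℤ.* + c₃) n
  combination-over z₁ z₂ z₃ c₁ c₂ c₃ n = begin
    toℚᵘ (t₁ ℚ.+ t₂ ℚ.+ t₃)                         ≈⟨ ℚₚ.toℚᵘ-homo-+ (t₁ ℚ.+ t₂) t₃ ⟩
    toℚᵘ (t₁ ℚ.+ t₂) ℚᵘ.+ toℚᵘ t₃                   ≈⟨ ℚᵘₚ.+-congˡ (toℚᵘ t₃) (ℚₚ.toℚᵘ-homo-+ t₁ t₂) ⟩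
    toℚᵘ t₁ ℚᵘ.+ toℚᵘ t₂ ℚᵘ.+ toℚᵘ t₃               ≈⟨ ℚᵘₚ.+-cong (ℚᵘₚ.+-cong (×-over z₁ c₁ n) (×-over z₂ c₂ n))
                                                                   (×-over z₃ c₃ n) ⟩
    mkℚᵘ d₁ n ℚᵘ.+ mkℚᵘ d₂ n ℚᵘ.+ mkℚᵘ d₃ n         ≈⟨ ℚᵘₚ.+-congˡ (mkℚᵘ d₃ n) (+-over d₁ d₂ n) ⟩
    mkℚᵘ (d₁ ℤ.+ d₂) n ℚᵘ.+ mkℚᵘ d₃ n               ≈⟨ +-over (d₁ ℤ.+ d₂) d₃ n ⟩
    mkℚᵘ (d₁ ℤ.+ d₂ ℤ.+ d₃) n                       ∎
    where
    open ℚᵘₚ.≃-Reasoning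
    t₁ = (z₁ / 1) ℚ.* (+ c₁ / suc n)
    t₂ = (z₂ / 1) ℚ.* (+ c₂ / suc n)
    t₃ = (z₃ / 1) ℚ.* (+ c₃ / suc n)
    d₁ = z₁ ℤ.* + c₁
    d₂ = z₂ ℤ.* + c₂
    d₃ = z₃ ℤ.* + c₃

  bounded-numerator⇒tendsToZero : ∀ (x : ℕ → ℚ) (D : ℕ → ℤ) B →
    (∀ n → toℚᵘ (x n) ≃ mkℚᵘ (D n) n) → (∀ n → ℤ.∣ D n ∣ ≤ B) → TendsToZero x
  bounded-numerator⇒tendsToZero x D B x≃D/n ∣D∣≤B (mkℚ +0 _ _)           (ℚ.*<* (ℤ.+<+ ()))
  bounded-numerator⇒tendsToZero x D B x≃D/n ∣D∣≤B (mkℚ -[1+ _ ] _ _)     (ℚ.*<* ())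
  bounded-numerator⇒tendsToZero x D B x≃D/n ∣D∣≤B ε@(mkℚ (+ suc p) d _) _ = B * suc d , small
    where
    small : ∀ n → B * suc d ≤ n → ℚ.∣ x n ∣ ℚ.< ε
    small n Bd≤n = ℚₚ.toℚᵘ-cancel-< (ℚᵘₚ.<-respˡ-≃ ∣D∣/n≃∣x∣ (*<* (subst₂ ℤ._<_
        (ℤₚ.pos-* ℤ.∣ D n ∣ (suc d)) (ℤₚ.pos-* (suc p) (suc n)) (ℤ.+<+ cross-multiplied))))
      where
      ∣D∣/n≃∣x∣ : mkℚᵘ (+ ℤ.∣ D n ∣) n ≃ toℚᵘ (ℚ.∣ x n ∣)
      ∣D∣/n≃∣x∣ = ℚᵘₚ.≃-sym (ℚᵘₚ.≃-trans (ℚₚ.toℚᵘ-homo-∣-∣ (x n)) (ℚᵘₚ.∣-∣-cong (x≃D/n n)))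

      cross-multiplied : ℤ.∣ D n ∣ * suc d < suc p * suc n
      cross-multiplied = begin-strict
        ℤ.∣ D n ∣ * suc d   ≤⟨ *-monoˡ-≤ (suc d) (∣D∣≤B n) ⟩
        B * suc d           ≤⟨ Bd≤n ⟩
        n                   <⟨ n<1+n n ⟩
        suc n               ≤⟨ m≤n*m (suc n) (suc p) ⟩
        suc p * suc n       ∎
        where open ≤-Reasoning

  private
    indicator-picks : ∀ y (c : Fin 3 → ℤ) →
      + Letter.δ y 0F ℤ.* c 0F ℤ.+ + Letter.δ y 1F ℤ.* c 1F ℤ.+ + Letter.δ y 2F ℤ.* c 2F ≡ c y
    indicator-picks 0F c = first (c 0F) (c 1F) (c 2F)
      where
      first : ∀ a b c → + 1 ℤ.* a ℤ.+ + 0 ℤ.* b ℤ.+ + 0 ℤ.* c ≡ a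
      first = ℤ-Solver.solve-∀
    indicator-picks 1F c = second (c 0F) (c 1F) (c 2F)
      where
      second : ∀ a b c → + 0 ℤ.* a ℤ.+ + 1 ℤ.* b ℤ.+ + 0 ℤ.* c ≡ b
      second = ℤ-Solver.solve-∀
    indicator-picks 2F c = third (c 0F) (c 1F) (c 2F)
      where
      third : ∀ a b c → + 0 ℤ.* a ℤ.+ + 0 ℤ.* b ℤ.+ + 1 ℤ.* c ≡ c
      third = ℤ-Solver.solve-∀

    /1≡0⇒≡0 : ∀ {i} → i / 1 ≡ 0ℚ → i ≡ + 0
    /1≡0⇒≡0 {i} i/1≡0 = trans (sym (ℚₚ.↥-/ i 1)) (cong (λ q → ℚ.↥ q ℤ.* gcd i (+ 1)) i/1≡0)

  -- The coefficients of n·f(y) − k·(f(1) + f(2) + f(3)).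
  indicator-coefficient : Fin 3 → ℕ → ℕ → Fin 3 → ℤ
  indicator-coefficient y n k a = + n ℤ.* + Letter.δ y a ℤ.- + k

  indicator-combination : ∀ y n k (c : Fin 3 → ℕ) → let z = indicator-coefficient y n k in
    z 0F ℤ.* + c 0F ℤ.+ z 1F ℤ.* + c 1F ℤ.+ z 2F ℤ.* + c 2F ≡ (n * c y) ⊖ (k * (c 0F + c 1F + c 2F))
  indicator-combination y n k c = begin
    (+ n ℤ.* d 0F ℤ.- + k) ℤ.* + c 0F ℤ.+ (+ n ℤ.* d 1F ℤ.- + k) ℤ.* + c 1F ℤ.+ (+ n ℤ.* d 2F ℤ.- + k) ℤ.* + c 2F
      ≡⟨ expand (+ n) (+ k) (d 0F) (d 1F) (d 2F) (+ c 0F) (+ c 1F) (+ c 2F) ⟩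
    + n ℤ.* (d 0F ℤ.* + c 0F ℤ.+ d 1F ℤ.* + c 1F ℤ.+ d 2F ℤ.* + c 2F) ℤ.- + k ℤ.* (+ c 0F ℤ.+ + c 1F ℤ.+ + c 2F)
      ≡⟨ cong₂ (λ u v → + n ℤ.* u ℤ.- + k ℤ.* v) (indicator-picks y (λ a → + c a)) (sym total) ⟩
    + n ℤ.* + c y ℤ.- + k ℤ.* + (c 0F + c 1F + c 2F)
      ≡⟨ cong₂ ℤ._-_ (sym (ℤₚ.pos-* n (c y))) (sym (ℤₚ.pos-* k (c 0F + c 1F + c 2F))) ⟩
    + (n * c y) ℤ.- + (k * (c 0F + c 1F + c 2F))
      ≡⟨ ℤₚ.m-n≡m⊖n (n * c y) (k * (c 0F + c 1F + c 2F)) ⟩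
    (n * c y) ⊖ (k * (c 0F + c 1F + c 2F))
      ∎
    where
    open ≡-Reasoning
    d : Fin 3 → ℤ
    d a = + Letter.δ y a
    expand : ∀ n k d₀ d₁ d₂ c₀ c₁ c₂ →
      (n ℤ.* d₀ ℤ.- k) ℤ.* c₀ ℤ.+ (n ℤ.* d₁ ℤ.- k) ℤ.* c₁ ℤ.+ (n ℤ.* d₂ ℤ.- k) ℤ.* c₂
        ≡ n ℤ.* (d₀ ℤ.* c₀ ℤ.+ d₁ ℤ.* c₁ ℤ.+ d₂ ℤ.* c₂) ℤ.- k ℤ.* (c₀ ℤ.+ c₁ ℤ.+ c₂)
    expand = ℤ-Solver.solve-∀
    total : + (c 0F + c 1F + c 2F) ≡ + c 0F ℤ.+ + c 1F ℤ.+ + c 2F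
    total = trans (ℤₚ.pos-+ (c 0F + c 1F) (c 2F)) (cong (ℤ._+ + c 2F) (ℤₚ.pos-+ (c 0F) (c 1F)))

  indicator-coefficients-nontrivial : ∀ y n k → let z = indicator-coefficient y (suc n) k in
    ¬ (z 0F / 1 ≡ 0ℚ × z 1F / 1 ≡ 0ℚ × z 2F / 1 ≡ 0ℚ)
  indicator-coefficients-nontrivial y n k vanish = 1+n≢0 (ℤₚ.+-injective (begin
    + suc n
      ≡⟨ gap (+ suc n) (+ k) ⟩
    (+ suc n ℤ.* + 1 ℤ.- + k) ℤ.- (+ suc n ℤ.* + 0 ℤ.- + k)
      ≡⟨ cong₂ (λ u v → (+ suc n ℤ.* + u ℤ.- + k) ℤ.- (+ suc n ℤ.* + v ℤ.- + k))
               (sym (Letter.δ-refl y)) (sym (δ-other y)) ⟩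
    z y ℤ.- z (other y)
      ≡⟨ cong₂ ℤ._-_ (vanishes y) (vanishes (other y)) ⟩
    + 0
      ∎))
    where
    open ≡-Reasoning
    z = indicator-coefficient y (suc n) k
    gap : ∀ n k → n ≡ (n ℤ.* + 1 ℤ.- k) ℤ.- (n ℤ.* + 0 ℤ.- k)
    gap = ℤ-Solver.solve-∀
    other : Fin 3 → Fin 3
    other 0F = 1F
    other 1F = 0F
    other 2F = 0F
    δ-other : ∀ a → Letter.δ a (other a) ≡ 0
    δ-other 0F = refl
    δ-other 1F = refl
    δ-other 2F = refl
    vanishes : ∀ a → z a ≡ + 0
    vanishes 0F = /1≡0⇒≡0 (proj₁ vanish)
    vanishes 1F = /1≡0⇒≡0 (proj₁ (proj₂ vanish))
    vanishes 2F = /1≡0⇒≡0 (proj₂ (proj₂ vanish))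

  module _ (w : Word) {y : Fin 3} {N K : ℕ} (window : ∀ i → occ y w (suc N) i ≡ K) where

    private
      N′ = suc N

      periodic : ∀ q i → occ y w (q * N′) i ≡ q * K
      periodic zero    i = refl
      periodic (suc q) i = trans (occ-+ y w N′ (q * N′) i) (cong₂ _+_ (window i) (periodic q (N′ + i)))

      prefix-deviation : ∀ M → ℤ.∣ (N′ * occ y w M 0) ⊖ (K * M) ∣ ≤ N′ * N′
      prefix-deviation M = begin
        ℤ.∣ (N′ * occ y w M 0) ⊖ (K * M) ∣    ≡⟨ cong ℤ.∣_∣ (cong₂ _⊖_ whole-periods-left whole-periods-right) ⟩
        ℤ.∣ (T + N′ * e) ⊖ (T + K * r) ∣      ≡⟨ cong ℤ.∣_∣ (ℤₚ.+-cancelˡ-⊖ T (N′ * e) (K * r)) ⟩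
        ℤ.∣ (N′ * e) ⊖ (K * r) ∣              ≤⟨ ℤₚ.∣m⊝n∣≤m⊔n (N′ * e) (K * r) ⟩
        N′ * e ⊔ K * r                        ≤⟨ ⊔-lub (*-monoʳ-≤ N′ e≤N′) (*-mono-≤ K≤N′ r≤N′) ⟩
        N′ * N′                               ∎
        where
        open ≤-Reasoning
        r = M % N′
        q = M div N′
        e = occ y w r 0
        T = q * K * N′

        r≤N′ : r ≤ N′
        r≤N′ = <⇒≤ (m%n<n M N′)
        e≤N′ : e ≤ N′
        e≤N′ = ≤-trans (occ≤ y w r 0) r≤N′
        K≤N′ : K ≤ N′
        K≤N′ = subst (_≤ N′) (window 0) (occ≤ y w N′ 0)

        M≡r+qN′ : M ≡ r + q * N′
        M≡r+qN′ = m≡m%n+[m/n]*n M N′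

        whole-periods-left : N′ * occ y w M 0 ≡ T + N′ * e
        whole-periods-left = begin-equality
          N′ * occ y w M 0              ≡⟨ cong (λ m → N′ * occ y w m 0) M≡r+qN′ ⟩
          N′ * occ y w (r + q * N′) 0   ≡⟨ cong (N′ *_) (occ-+ y w r (q * N′) 0) ⟩
          N′ * (e + occ y w (q * N′) (r + 0)) ≡⟨ cong (λ z → N′ * (e + z)) (periodic q (r + 0)) ⟩
          N′ * (e + q * K)              ≡⟨ regroup N′ e q K ⟩
          T + N′ * e                    ∎
          where
          regroup : ∀ n e q k → n * (e + q * k) ≡ q * k * n + n * e
          regroup = solve-∀

        whole-periods-right : K * M ≡ T + K * r
        whole-periods-right = trans (cong (K *_) M≡r+qN′) (regroup K r q N′)
          where
          regroup : ∀ k r q n → k * (r + q * n) ≡ q * k * n + k * r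
          regroup = solve-∀

    constant-window-count⇒dependent : ¬ RatIndepFreq w
    constant-window-count⇒dependent independent =
      independent (z 0F / 1) (z 1F / 1) (z 2F / 1) (indicator-coefficients-nontrivial y N K)
        (bounded-numerator⇒tendsToZero _ D (N′ * N′)
          (λ n → combination-over (z 0F) (z 1F) (z 2F) (c n 0F) (c n 1F) (c n 2F) n)
          (λ n → subst (λ d → ℤ.∣ d ∣ ≤ N′ * N′) (sym (D≡ n)) (prefix-deviation (suc n))))
      where
      z : Fin 3 → ℤ
      z = indicator-coefficient y N′ K

      c : ℕ → Fin 3 → ℕ
      c n a = count a (factor w 0 (suc n))

      D : ℕ → ℤ
      D n = z 0F ℤ.* + c n 0F ℤ.+ z 1F ℤ.* + c n 1F ℤ.+ z 2F ℤ.* + c n 2F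

      D≡ : ∀ n → D n ≡ (N′ * occ y w (suc n) 0) ⊖ (K * suc n)
      D≡ n = trans (indicator-combination y N′ K (c n)) (cong₂ (λ u v → (N′ * u) ⊖ (K * v))
        (count-factor w y 0 (suc n)) (count-total w 0 (suc n)))

surplus-of-first : ∀ {a b c a′ b′ c′} → a ≡ 2 + a′ → a + b + c ≡ a′ + b′ + c′ →
  b′ ≤ 2 + b → b′ + (c′ + c′) ≤ 2 + (b + (c + c)) → a + b ≡ a′ + b′
surplus-of-first {a} {b} {c} {a′} {b′} {c′} a≡2+a′ same-total b′≤2+b weighted≤ =
  +-cancelʳ-≡ c _ _ (trans same-total (cong (a′ + b′ +_) (sym c≡c′)))
  where
  open ≤-Reasoning

  balance : 2 + b + c ≡ b′ + c′
  balance = +-cancelˡ-≡ a′ _ _ (begin-equality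
    a′ + (2 + b + c)   ≡⟨ regroup a′ b c ⟩
    2 + a′ + b + c     ≡⟨ cong (λ x → x + b + c) (sym a≡2+a′) ⟩
    a + b + c          ≡⟨ same-total ⟩
    a′ + b′ + c′       ≡⟨ +-assoc a′ b′ c′ ⟩
    a′ + (b′ + c′)     ∎)
    where
    regroup : ∀ a′ b c → a′ + (2 + b + c) ≡ 2 + a′ + b + c
    regroup = solve-∀

  c≡c′ : c ≡ c′
  c≡c′ = ≤-antisym
    (+-cancelˡ-≤ (2 + b) _ _ (begin
      2 + b + c          ≡⟨ balance ⟩
      b′ + c′            ≤⟨ +-monoˡ-≤ c′ b′≤2+b ⟩
      2 + b + c′         ∎))
    (+-cancelˡ-≤ (2 + b + c) _ _ (begin
      2 + b + c + c′     ≡⟨ cong (_+ c′) balance ⟩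
      b′ + c′ + c′       ≡⟨ +-assoc b′ c′ c′ ⟩
      b′ + (c′ + c′)     ≤⟨ weighted≤ ⟩
      2 + (b + (c + c))  ≡⟨ regroup b c ⟩
      2 + b + c + c      ∎))
    where
    regroup : ∀ b c → 2 + (b + (c + c)) ≡ 2 + b + c + c
    regroup = solve-∀

surplus-of-third : ∀ {a b c a′ b′ c′} → c ≡ 2 + c′ → a + b + c ≡ a′ + b′ + c′ →
  b′ ≤ 2 + b → b + (c + c) ≤ 2 + (b′ + (c′ + c′)) → a ≡ a′ × b + (c + c) ≡ 2 + (b′ + (c′ + c′))
surplus-of-third {a} {b} {c} {a′} {b′} {c′} refl same-total b′≤2+b weighted≤ =
  +-cancelʳ-≡ (2 + b + c′) _ _ (begin-equality
    a + (2 + b + c′)      ≡⟨ regroup₁ a b c′ ⟩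
    a + b + (2 + c′)      ≡⟨ same-total ⟩
    a′ + b′ + c′          ≡⟨ cong (λ x → a′ + x + c′) b′≡2+b ⟩
    a′ + (2 + b) + c′     ≡⟨ +-assoc a′ (2 + b) c′ ⟩
    a′ + (2 + b + c′)     ∎) ,
  (begin-equality
    b + (c + c)           ≡⟨ regroup₂ b c′ ⟩
    2 + (2 + b + (c′ + c′)) ≡⟨ cong (λ x → 2 + (x + (c′ + c′))) (sym b′≡2+b) ⟩
    2 + (b′ + (c′ + c′))  ∎)
  where
  open ≤-Reasoning
  regroup₁ : ∀ a b c′ → a + (2 + b + c′) ≡ a + b + (2 + c′)
  regroup₁ = solve-∀
  regroup₂ : ∀ b c′ → b + ((2 + c′) + (2 + c′)) ≡ 2 + (2 + b + (c′ + c′))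
  regroup₂ = solve-∀

  b′≡2+b : b′ ≡ 2 + b
  b′≡2+b = ≤-antisym b′≤2+b (+-cancelʳ-≤ (2 + (c′ + c′)) _ _ (begin
    2 + b + (2 + (c′ + c′))  ≡⟨ regroup₃ b c′ ⟩
    b + (c + c)              ≤⟨ weighted≤ ⟩
    2 + (b′ + (c′ + c′))     ≡⟨ regroup₄ b′ c′ ⟩
    b′ + (2 + (c′ + c′))     ∎))
    where
    regroup₃ : ∀ b c′ → 2 + b + (2 + (c′ + c′)) ≡ b + ((2 + c′) + (2 + c′))
    regroup₃ = solve-∀
    regroup₄ : ∀ b′ c′ → 2 + (b′ + (c′ + c′)) ≡ b′ + (2 + (c′ + c′))
    regroup₄ = solve-∀

OneOf : {X : Set} → X → X → X → X → Set
OneOf x v₁ v₂ v₃ = x ≡ v₁ ⊎ x ≡ v₂ ⊎ x ≡ v₃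

classify : ∀ {X : Set} {v₁ v₂ v₃ x : X} → OneOf x v₁ v₂ v₃ → Fin 3
classify (inj₁ _)        = 0F
classify (inj₂ (inj₁ _)) = 1F
classify (inj₂ (inj₂ _)) = 2F

lookup-classify : ∀ {X : Set} {v₁ v₂ v₃ x : X} (x∈ : OneOf x v₁ v₂ v₃) →
                  lookup (v₁ ∷ v₂ ∷ v₃ ∷ []) (classify x∈) ≡ x
lookup-classify (inj₁ refl)        = refl
lookup-classify (inj₂ (inj₁ refl)) = refl
lookup-classify (inj₂ (inj₂ refl)) = refl

component : Fin 3 → AbVec → ℕ
component 0F (n , _ , _) = n
component 1F (_ , n , _) = n
component 2F (_ , _ , n) = n

component-ab : ∀ x u → component x (ab u) ≡ count x u
component-ab 0F u = refl
component-ab 1F u = refl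
component-ab 2F u = refl

module WindowClasses (w : Word) (N : ℕ) (three-classes : ρ≤3 w N) where

  private
    classes : Vec AbVec 3
    classes = proj₁ three-classes ∷ proj₁ (proj₂ three-classes) ∷ proj₁ (proj₂ (proj₂ three-classes)) ∷ []
    member = proj₂ (proj₂ (proj₂ three-classes))

  κ : ℕ → Fin 3
  κ k = classify (member k)

  same-class⇒same-vector : ∀ {a b} → κ a ≡ κ b → ab (factor w a N) ≡ ab (factor w b N)
  same-class⇒same-vector {a} {b} e =
    trans (sym (lookup-classify (member a))) (trans (cong (lookup classes) e) (lookup-classify (member b)))

  letter-count-factors : ∀ x → occ x w N FactorsThrough κ
  letter-count-factors x {a} {b} e = begin
    occ x w N a                       ≡⟨ sym (count-factor w x a N) ⟩
    count x (factor w a N)            ≡⟨ sym (component-ab x (factor w a N)) ⟩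
    component x (ab (factor w a N))   ≡⟨ cong (component x) (same-class⇒same-vector e) ⟩
    component x (ab (factor w b N))   ≡⟨ component-ab x (factor w b N) ⟩
    count x (factor w b N)            ≡⟨ count-factor w x b N ⟩
    occ x w N b                       ∎
    where open ≡-Reasoning

module Block = WindowCount _≟ab_

module BlockDecomposition (w : Word) (ℓ r s t : ℕ)
  (typed : ∀ k → OneOf (induced w (suc ℓ) k) (r , suc s , suc t) (r + 1 , s , suc t) (r + 2 , s , t))
  where

  L : ℕ
  L = suc ℓ

  A B C : AbVec
  A = r , suc s , suc t
  B = r + 1 , s , suc t
  C = r + 2 , s , t

  h : ℕ → AbVec
  h = induced w L

  a b c : ℕ → ℕ → ℕ
  a = Block.occ A h
  b = Block.occ B h
  c = Block.occ C h

  X Y Z : ℕ → ℕ → ℕ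
  X m i = occ 0F w (m * L) (i * L)
  Y m i = occ 1F w (m * L) (i * L)
  Z m i = occ 2F w (m * L) (i * L)

  private
    open Block using (δ)

    A≢B : A ≢ B
    A≢B e = <⇒≢ (m<m+n r z<s) (cong proj₁ e)
    A≢C : A ≢ C
    A≢C e = <⇒≢ (m<m+n r z<s) (cong proj₁ e)
    B≢C : B ≢ C
    B≢C e = <⇒≢ (+-monoʳ-< r (n<1+n 1)) (cong proj₁ e)

  shape : AbVec → AbVec
  shape v = r + (δ B v + (δ C v + δ C v)) , s + δ A v , t + (δ A v + δ B v)

  shape-of-type : ∀ {v} → OneOf v A B C → δ A v + δ B v + δ C v ≡ 1 × v ≡ shape v
  shape-of-type (inj₁ refl)
    rewrite Block.δ-refl A | Block.δ-≢ A≢B | Block.δ-≢ A≢C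
    = refl , cong₂ _,_ (sym (+-identityʳ r)) (cong₂ _,_ (+-comm 1 s) (+-comm 1 t))
  shape-of-type (inj₂ (inj₁ refl))
    rewrite Block.δ-refl B | Block.δ-≢ (A≢B ∘ sym) | Block.δ-≢ B≢C
    = refl , cong₂ _,_ refl (cong₂ _,_ (sym (+-identityʳ s)) (+-comm 1 t))
  shape-of-type (inj₂ (inj₂ refl))
    rewrite Block.δ-refl C | Block.δ-≢ (A≢C ∘ sym) | Block.δ-≢ (B≢C ∘ sym)
    = refl , cong₂ _,_ refl (cong₂ _,_ (sym (+-identityʳ s)) (sym (+-identityʳ t)))

  record BlockWindow (m i : ℕ) : Set where
    field
      types    : a m i + b m i + c m i ≡ m
      letter-1 : X m i ≡ m * r + (b m i + (c m i + c m i))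
      letter-2 : Y m i ≡ m * s + a m i
      letter-3 : Z m i ≡ m * t + (a m i + b m i)

  split-first-block : ∀ x m i → occ x w (suc m * L) (i * L) ≡ component x (shape (h i)) + occ x w (m * L) (suc i * L)
  split-first-block x m i = begin
    occ x w (suc m * L) (i * L)                         ≡⟨ Letter.occ-+ x w L (m * L) (i * L) ⟩
    occ x w L (i * L) + occ x w (m * L) (suc i * L)     ≡⟨ cong (_+ occ x w (m * L) (suc i * L)) first-block ⟩
    component x (shape (h i)) + occ x w (m * L) (suc i * L) ∎
    where
    open ≡-Reasoning
    first-block : occ x w L (i * L) ≡ component x (shape (h i))
    first-block = begin
      occ x w L (i * L)              ≡⟨ sym (count-factor w x (i * L) L) ⟩
      count x (factor w (i * L) L)   ≡⟨ sym (component-ab x (factor w (i * L) L)) ⟩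
      component x (h i)              ≡⟨ cong (component x) (proj₂ (shape-of-type (typed i))) ⟩
      component x (shape (h i))      ∎

  window-of-blocks : ∀ m i → BlockWindow m i
  window-of-blocks zero    i = record { types = refl ; letter-1 = refl ; letter-2 = refl ; letter-3 = refl }
  window-of-blocks (suc m) i = record
    { types    = trans (regroup-types dA dB dC (a m (suc i)) (b m (suc i)) (c m (suc i)))
                       (cong₂ _+_ (proj₁ (shape-of-type (typed i))) types)
    ; letter-1 = trans (split-first-block 0F m i)
                       (trans (cong (component 0F (shape (h i)) +_) letter-1) (regroup-1 r m dB dC (b m (suc i)) (c m (suc i))))
    ; letter-2 = trans (split-first-block 1F m i)
                       (trans (cong (component 1F (shape (h i)) +_) letter-2) (regroup-2 s m dA (a m (suc i))))
    ; letter-3 = trans (split-first-block 2F m i)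
                       (trans (cong (component 2F (shape (h i)) +_) letter-3) (regroup-3 t m dA dB (a m (suc i)) (b m (suc i))))
    }
    where
    open BlockWindow (window-of-blocks m (suc i))
    dA = δ A (h i)
    dB = δ B (h i)
    dC = δ C (h i)
    regroup-types : ∀ dA dB dC a b c → (dA + a) + (dB + b) + (dC + c) ≡ (dA + dB + dC) + (a + b + c)
    regroup-types = solve-∀
    regroup-1 : ∀ r m dB dC b c → r + (dB + (dC + dC)) + (m * r + (b + (c + c)))
                                  ≡ suc m * r + ((dB + b) + ((dC + c) + (dC + c)))
    regroup-1 = solve-∀
    regroup-2 : ∀ s m dA a → s + dA + (m * s + a) ≡ suc m * s + (dA + a)
    regroup-2 = solve-∀
    regroup-3 : ∀ t m dA dB a b → t + (dA + dB) + (m * t + (a + b)) ≡ suc m * t + ((dA + a) + (dB + b))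
    regroup-3 = solve-∀

  module _ (ρ : ∀ m → ρ≤3 w (suc m)) (independent : RatIndepFreq w) (n : ℕ) where

    private
      N = suc n * L
      open WindowClasses w N (ρ (ℓ + n * L))

      lip : ∀ x → OneLipschitz (occ x w N)
      lip x = Letter.occ-oneLipschitz x w N

      fac : ∀ x → occ x w N FactorsThrough κ
      fac = letter-count-factors

      total : ∀ k → occ 0F w N k + occ 1F w N k + occ 2F w N k ≡ N
      total = letter-total w N

      module W k = BlockWindow (window-of-blocks (suc n) k)

      two-ahead : ∀ k v → k + (2 + v) ≡ 2 + (k + v)
      two-ahead k v = trans (+-suc k (suc v)) (cong suc (+-suc k v))

      X-spread : ∀ i j → X (suc n) i ≤ 2 + X (suc n) j
      X-spread i j = ≤-pred (spread< κ (lip 0F) (fac 0F) (i * L) (j * L))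

      weighted-spread : ∀ i j → b (suc n) i + (c (suc n) i + c (suc n) i) ≤ 2 + (b (suc n) j + (c (suc n) j + c (suc n) j))
      weighted-spread i j = +-cancelˡ-≤ (suc n * r) _ _ (begin
        suc n * r + (b (suc n) i + (c (suc n) i + c (suc n) i))        ≡⟨ sym (W.letter-1 i) ⟩
        X (suc n) i                                                    ≤⟨ X-spread i j ⟩
        2 + X (suc n) j                                                ≡⟨ cong (2 +_) (W.letter-1 j) ⟩
        2 + (suc n * r + (b (suc n) j + (c (suc n) j + c (suc n) j)))  ≡⟨ sym (two-ahead (suc n * r) _) ⟩
        suc n * r + (2 + (b (suc n) j + (c (suc n) j + c (suc n) j)))  ∎)
        where
        open ≤-Reasoning

      b-factors : b (suc n) FactorsThrough (κ ∘ (_* L))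
      b-factors {i} {j} same = +-cancelˡ-≡ (a (suc n) i) _ _ (trans a+b≡ (cong (_+ b (suc n) j) (sym a≡)))
        where
        a≡ : a (suc n) i ≡ a (suc n) j
        a≡ = +-cancelˡ-≡ (suc n * s) _ _ (trans (sym (W.letter-2 i)) (trans (fac 1F same) (W.letter-2 j)))
        a+b≡ : a (suc n) i + b (suc n) i ≡ a (suc n) j + b (suc n) j
        a+b≡ = +-cancelˡ-≡ (suc n * t) _ _ (trans (sym (W.letter-3 i)) (trans (fac 2F same) (W.letter-3 j)))

      b-spread : ∀ i j → b (suc n) i ≤ 2 + b (suc n) j
      b-spread i j = ≤-pred (spread< (κ ∘ (_* L)) (Block.occ-oneLipschitz B h (suc n)) b-factors i j)

      same-types : ∀ i j → a (suc n) i + b (suc n) i + c (suc n) i ≡ a (suc n) j + b (suc n) j + c (suc n) j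
      same-types i j = trans (W.types i) (sym (W.types j))

    no-surplus-of-A : ∀ i j → a (suc n) i ≡ 2 + a (suc n) j → ⊥
    no-surplus-of-A i j surplus = constant-window-count⇒dependent w {N = ℓ + n * L}
      (steady-count-is-constant κ (lip 1F) (lip 0F) (fac 1F) (fac 2F) (fac 0F) total′ Yᵢ≡2+Yⱼ Zᵢ≡Zⱼ)
      independent
      where
      total′ : ∀ k → occ 1F w N k + occ 2F w N k + occ 0F w N k ≡ N
      total′ k = trans (rotate (occ 0F w N k) _ _) (total k)
        where
        rotate : ∀ x y z → y + z + x ≡ x + y + z
        rotate = solve-∀
      Yᵢ≡2+Yⱼ : Y (suc n) i ≡ 2 + Y (suc n) j
      Yᵢ≡2+Yⱼ = begin
        Y (suc n) i                     ≡⟨ W.letter-2 i ⟩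
        suc n * s + a (suc n) i         ≡⟨ cong (suc n * s +_) surplus ⟩
        suc n * s + (2 + a (suc n) j)   ≡⟨ two-ahead (suc n * s) _ ⟩
        2 + (suc n * s + a (suc n) j)   ≡⟨ cong (2 +_) (sym (W.letter-2 j)) ⟩
        2 + Y (suc n) j                 ∎
        where open ≡-Reasoning
      Zᵢ≡Zⱼ : Z (suc n) i ≡ Z (suc n) j
      Zᵢ≡Zⱼ = trans (W.letter-3 i) (trans (cong (suc n * t +_)
                (surplus-of-first surplus (same-types i j) (b-spread j i) (weighted-spread j i)))
                (sym (W.letter-3 j)))

    no-surplus-of-C : ∀ i j → c (suc n) i ≡ 2 + c (suc n) j → ⊥
    no-surplus-of-C i j surplus = constant-window-count⇒dependent w {N = ℓ + n * L}
      (steady-count-is-constant κ (lip 0F) (lip 2F) (fac 0F) (fac 1F) (fac 2F) total Xᵢ≡2+Xⱼ Yᵢ≡Yⱼ)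
      independent
      where
      balance = surplus-of-third surplus (same-types i j) (b-spread j i) (weighted-spread i j)
      Xᵢ≡2+Xⱼ : X (suc n) i ≡ 2 + X (suc n) j
      Xᵢ≡2+Xⱼ = trans (W.letter-1 i) (trans (cong (suc n * r +_) (proj₂ balance))
                  (trans (two-ahead (suc n * r) _) (cong (2 +_) (sym (W.letter-1 j)))))
      Yᵢ≡Yⱼ : Y (suc n) i ≡ Y (suc n) j
      Yᵢ≡Yⱼ = trans (W.letter-2 i) (trans (cong (suc n * s +_) (proj₁ balance)) (sym (W.letter-2 j)))

    surplus-only-for-B : ∀ {α} → OneOf α A B C →
      ∀ i j → Block.occ α h (suc n) i ≡ 2 + Block.occ α h (suc n) j → α ≡ B
    surplus-only-for-B (inj₁ refl)        i j = ⊥-elim ∘ no-surplus-of-A i j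
    surplus-only-for-B (inj₂ (inj₁ α≡B)) _ _ _ = α≡B
    surplus-only-for-B (inj₂ (inj₂ refl)) i j = ⊥-elim ∘ no-surplus-of-C i j

size : AbVec → ℕ
size (x , y , z) = x + y + z

size-ab-factor : ∀ w n {v} → InAbL w n v → size v ≡ n
size-ab-factor w n (i , refl) = count-total w i n

same-size : ∀ w n {u v} → InAbL w n u → InAbL w n v → size u ≡ size v
same-size w n u∈ v∈ = trans (size-ab-factor w n u∈) (sym (size-ab-factor w n v∈))

surplus-in-blocks : ∀ w L α i j n → countInd α (indFactor w L i n) ≡ countInd α (indFactor w L j n) + 2 →
                    Block.occ α (induced w L) n i ≡ 2 + Block.occ α (induced w L) n j
surplus-in-blocks w L α i j n surplus = trans (sym (Block.count-window α (induced w L) i n))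
  (trans surplus (trans (cong (_+ 2) (Block.count-window α (induced w L) j n)) (+-comm _ 2)))

lemma20 : (w : Word) → ((n : ℕ) → ρ≤3 w (suc n)) → HasFrequencies w → RatIndepFreq w →
    (ℓ r s t : ℕ) →
    AbLEq w (suc ℓ) (r , s , t) (r + 1 , s ∸ 1 , t) (r + 2 , s ∸ 1 , t ∸ 1) →
    (n i j : ℕ) → (α : AbVec) → InAbL w (suc ℓ) α →
    countInd α (indFactor w (suc ℓ) i (suc n)) ≡ countInd α (indFactor w (suc ℓ) j (suc n)) + 2 →
    α ≡ (r + 1 , s ∸ 1 , t)
-- For s = 0 or t = 0 the truncated s ∸ 1, t ∸ 1 make two prescribed vectors differ in size.
lemma20 w ρ _ independent ℓ r 0 t (_ , A∈ , B∈ , _) n i j α α∈ surplus =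
  ⊥-elim (m≢1+n+m (r + 0 + t) {0} (trans (same-size w (suc ℓ) A∈ B∈) (regroup r t)))
  where
  regroup : ∀ r t → r + 1 + 0 + t ≡ 1 + (r + 0 + t)
  regroup = solve-∀
lemma20 w ρ _ independent ℓ r (suc s) 0 (_ , _ , B∈ , C∈) n i j α α∈ surplus =
  ⊥-elim (m≢1+n+m (r + 1 + s + 0) {0} (trans (same-size w (suc ℓ) B∈ C∈) (regroup r s)))
  where
  regroup : ∀ r s → r + 2 + s + 0 ≡ 1 + (r + 1 + s + 0)
  regroup = solve-∀
lemma20 w ρ _ independent ℓ r (suc s) (suc t) (only-three , _) n i j α α∈ surplus =
  surplus-only-for-B ρ independent n (only-three α α∈) i j (surplus-in-blocks w (suc ℓ) α i j (suc n) surplus)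
  where open BlockDecomposition w ℓ r s t (λ k → only-three _ (k * suc ℓ , refl))
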